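{- Let $D=\{1,\dots,k\}$, $D'=\{0\}\cup D$ and $d,d'\in D$. The function $f:D'^2\to\mathbb{R}$ given on $D^2$ by $f(x,y)=0$ if $x=d$ or $y=d'$ and $f(x,y)=1$ otherwise, with $f(d,0)=f(0,d')=f(0,0)=0$ and $f(a,0)=f(0,b)=1/2$ for $a\in D\setminus\{d\}$, $b\in D\setminus\{d'\}$, is $k$-submodular representable.
   Context: For a variable set $X$ and $v\in X$, $X_v=\{v_i:i\in D\}$; an $(X,k)$-network is a network with capacities $c\ge0$ on vertices $\{s,t\}\cup\bigcup_v X_v$; the capacity of an $s$-$t$ cut $S$ is the total capacity of edges leaving $S$. For $\phi:X\to D'$, $S_\phi=\{s\}\cup\{v_{\phi(v)}:\phi(v)\ne0\}$; $\nu(S)=\{s\}\cup\{v_i:S\cap X_v=\{v_i\}\}$. A network represents $f$ if $c(S_\phi)=f(\phi)$ for all $\phi$, and is $k$-submodular if $c(S)\ge c(\nu(S))$ for all $s$-$t$ cuts $S$. $f$ is $k$-submodular representable if some $k$-submodular $(X,k)$-network represents it (here $X=\{x,y\}$). -}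

module Defs where

open import Data.Bool using (Bool; true; false; _∧_; not; if_then_else_)
open import Data.Nat using (ℕ; zero; suc)
import Data.Nat as ℕ
open import Data.Fin using (Fin; zero; suc)
import Data.Fin as Fin
open import Data.List using (List; []; _∷_; map; _++_; foldr; filter; length)
open import Data.List using () renaming (allFin to allFinL)
open import Data.Product using (Σ; _×_; _,_)
open import Data.Rational using (ℚ; 0ℚ; 1ℚ; ½; _+_; _≤_)
open import Relation.Nullary.Decidable using (⌊_⌋)
open import Relation.Binary.PropositionalEquality using (_≡_)

-- D = {1,…,k} is modelled by Fin k; D' = {0} ∪ D by Fin (suc k),
-- where zero stands for the label 0 and (suc i) for the label i ∈ D.
D : ℕ → Set
D k = Fin k

D′ : ℕ → Set
D′ k = Fin (suc k)

data Var : Set where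
  x y : Var

data Vertex (k : ℕ) : Set where
  s t : Vertex k
  node : Var → D k → Vertex k

allVertices : (k : ℕ) → List (Vertex k)
allVertices k = s ∷ t ∷ (map (node x) (allFinL k) ++ map (node y) (allFinL k))

Capacity : ℕ → Set
Capacity k = Vertex k → Vertex k → ℚ

VSet : ℕ → Set
VSet k = Vertex k → Bool

IsCut : {k : ℕ} → VSet k → Set
IsCut S = (S s ≡ true) × (S t ≡ false)

sumℚ : List ℚ → ℚ
sumℚ = foldr _+_ 0ℚ

cutCap : {k : ℕ} → Capacity k → VSet k → ℚ
cutCap {k} c S =
  sumℚ (map (λ u → sumℚ (map (λ w → if S u ∧ not (S w) then c u w else 0ℚ)
                               (allVertices k)))
            (allVertices k))

Sφ : {k : ℕ} → (Var → D′ k) → VSet k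
Sφ φ s = true
Sφ φ t = false
Sφ φ (node v i) = ⌊ φ v Fin.≟ suc i ⌋

countIn : {k : ℕ} → VSet k → Var → ℕ
countIn {k} S v = length (filter (λ i → Data.Bool._≟_ (S (node v i)) true) (allFinL k))
  where import Data.Bool

ν : {k : ℕ} → VSet k → VSet k
ν S s = true
ν S t = false
ν S (node v i) = S (node v i) ∧ ⌊ countIn S v ℕ.≟ 1 ⌋

Represents : {k : ℕ} → Capacity k → ((Var → D′ k) → ℚ) → Set
Represents c f = ∀ φ → cutCap c (Sφ φ) ≡ f φ

IsKSubmodularNetwork : {k : ℕ} → Capacity k → Set
IsKSubmodularNetwork c = ∀ S → IsCut S → cutCap c (ν S) ≤ cutCap c S

NonNeg : {k : ℕ} → Capacity k → Set
NonNeg c = ∀ u w → 0ℚ ≤ c u w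

KSubmodularRepresentable : {k : ℕ} → ((Var → D′ k) → ℚ) → Set
KSubmodularRepresentable {k} f =
  Σ (Capacity k) λ c → NonNeg c × Represents c f × IsKSubmodularNetwork c

f₀ : {k : ℕ} → D k → D k → D′ k → D′ k → ℚ
f₀ d d′ zero zero = 0ℚ
f₀ d d′ (suc a) zero = if ⌊ a Fin.≟ d ⌋ then 0ℚ else ½
f₀ d d′ zero (suc b) = if ⌊ b Fin.≟ d′ ⌋ then 0ℚ else ½
f₀ d d′ (suc a) (suc b) = if ⌊ a Fin.≟ d ⌋ ∨ ⌊ b Fin.≟ d′ ⌋ then 0ℚ else 1ℚ
  where open import Data.Bool using (_∨_)

fφ : {k : ℕ} → D k → D k → (Var → D′ k) → ℚ
fφ d d′ φ = f₀ d d′ (φ x) (φ y)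

-- The network has an edge of capacity ½ from x_i to y_d′ for every i ≠ d and from y_j to x_d for every
-- j ≠ d′, so a cut S has capacity ½ (A [y_d′ ∉ S] + B [x_d ∉ S]), where A counts the x_i (i ≠ d) and B the
-- y_j (j ≠ d′) in S; on S_φ this is f(φ). The map ν keeps the trace of S on X_v if it is a single vertex and
-- empties it otherwise. Emptying both traces only lowers the count; if only the x-trace survives it
-- contributes at most the edges of one vertex, and if that is an x_i with i ≠ d whose edge was not cut in S,
-- then y_d′ ∈ S, so the y-trace, not being a single vertex, contains some y_j (j ≠ d′) with a cut edge to x_d.
module Submission where

open import Defs
open import Data.Nat using (ℕ)

open import Data.Bool using (Bool; true; false; _∧_; not; if_then_else_)
import Data.Bool as Bool
open import Data.Bool.Properties using (∧-identityʳ; ∧-zeroʳ; ∧-comm)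
open import Data.Empty using (⊥-elim)
open import Data.Fin using (Fin; zero; suc; _≟_)
open import Data.List using (List; []; _∷_; map; _++_; filter; length; allFin)
open import Data.List.Properties using (map-cong; map-++; map-∘; map-tabulate)
open import Data.Nat using (zero; suc; _+_; _≤_; z≤n; s≤s)
import Data.Nat as ℕ
open import Data.Nat.ListAction using (sum)
open import Data.Nat.ListAction.Properties using (sum-++)
open import Data.Nat.Properties using (+-comm; +-identityʳ; ≤-refl; +-commutativeSemigroup)
open import Data.Product using (_×_; _,_)
open import Data.Rational using (ℚ; 0ℚ; ½) renaming (_+_ to _+ℚ_; _≤_ to _≤ℚ_)
import Data.Rational.Properties as ℚ
open import Function using (_∘_; id)
open import Relation.Nullary using (yes; no)
open import Relation.Nullary.Decidable using (⌊_⌋)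
open import Relation.Binary.PropositionalEquality
  using (_≡_; _≢_; refl; sym; trans; cong; cong₂; subst₂; module ≡-Reasoning)
open import Algebra.Properties.CommutativeSemigroup +-commutativeSemigroup
  using () renaming (interchange to +-interchange)

[_] : Bool → ℕ
[ b ] = if b then 1 else 0

⌊≟⌋-sym : ∀ {k} (a b : Fin k) → ⌊ a ≟ b ⌋ ≡ ⌊ b ≟ a ⌋
⌊≟⌋-sym a b with a ≟ b | b ≟ a
... | yes _   | yes _   = refl
... | no _    | no _    = refl
... | yes a≡b | no b≢a = ⊥-elim (b≢a (sym a≡b))
... | no a≢b  | yes b≡a = ⊥-elim (a≢b (sym b≡a))

⌊≟⌋-suc : ∀ {k} (a b : Fin k) → ⌊ suc a ≟ suc b ⌋ ≡ ⌊ a ≟ b ⌋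
⌊≟⌋-suc a b with a ≟ b
... | yes _ = refl
... | no _  = refl

∑ : {A : Set} → List A → (A → ℕ) → ℕ
∑ l g = sum (map g l)

module _ {A : Set} where

  ∑-cong : (l : List A) {g h : A → ℕ} → (∀ a → g a ≡ h a) → ∑ l g ≡ ∑ l h
  ∑-cong l g≗h = cong sum (map-cong g≗h l)

  ∑-zero : (l : List A) {g : A → ℕ} → (∀ a → g a ≡ 0) → ∑ l g ≡ 0
  ∑-zero [] g≗0 = refl
  ∑-zero (a ∷ l) g≗0 rewrite g≗0 a = ∑-zero l g≗0

  ∑-++ : (l l′ : List A) (g : A → ℕ) → ∑ (l ++ l′) g ≡ ∑ l g + ∑ l′ g
  ∑-++ l l′ g = trans (cong sum (map-++ g l l′)) (sum-++ (map g l) (map g l′))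

  ∑-map : {B : Set} (f : B → A) (l : List B) (g : A → ℕ) → ∑ (map f l) g ≡ ∑ l (g ∘ f)
  ∑-map f l g = cong sum (sym (map-∘ l))

  ∑-+ : (l : List A) (g h : A → ℕ) → ∑ l (λ a → g a + h a) ≡ ∑ l g + ∑ l h
  ∑-+ [] g h = refl
  ∑-+ (a ∷ l) g h = trans (cong (g a + h a +_) (∑-+ l g h)) (+-interchange (g a) (h a) (∑ l g) (∑ l h))

  ∑-unless : (l : List A) (b : Bool) (g : A → ℕ) →
             ∑ l (λ a → if b then 0 else g a) ≡ (if b then 0 else ∑ l g)
  ∑-unless l true g = ∑-zero l (λ _ → refl)
  ∑-unless l false g = refl

  length-filter-≡true : (P : A → Bool) (l : List A) →
                        length (filter (λ a → P a Bool.≟ true) l) ≡ ∑ l (λ a → [ P a ])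
  length-filter-≡true P [] = refl
  length-filter-≡true P (a ∷ l) with P a
  ... | true = cong suc (length-filter-≡true P l)
  ... | false = length-filter-≡true P l

∑-allFin-suc : ∀ {k} (g : Fin (suc k) → ℕ) → ∑ (allFin (suc k)) g ≡ g zero + ∑ (allFin k) (g ∘ suc)
∑-allFin-suc g = cong (g zero +_) (cong sum (trans (map-tabulate suc g) (sym (map-tabulate id (g ∘ suc)))))

∑-point : ∀ {k} (e : Fin k) (g : Fin k → Bool → ℕ) → (∀ j → g j false ≡ 0) →
          ∑ (allFin k) (λ j → g j ⌊ j ≟ e ⌋) ≡ g e true
∑-point {suc k} zero g g-false≡0 = begin
  ∑ (allFin (suc k)) (λ j → g j ⌊ j ≟ zero ⌋)          ≡⟨ ∑-allFin-suc (λ j → g j ⌊ j ≟ zero ⌋) ⟩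
  g zero true + ∑ (allFin k) (λ j → g (suc j) false) ≡⟨ cong (g zero true +_) (∑-zero (allFin k) (g-false≡0 ∘ suc)) ⟩
  g zero true + 0                                     ≡⟨ +-identityʳ _ ⟩
  g zero true                                         ∎
  where open ≡-Reasoning
∑-point {suc k} (suc e) g g-false≡0 = begin
  ∑ (allFin (suc k)) (λ j → g j ⌊ j ≟ suc e ⌋)            ≡⟨ ∑-allFin-suc (λ j → g j ⌊ j ≟ suc e ⌋) ⟩
  g zero false + ∑ (allFin k) (λ j → g (suc j) ⌊ suc j ≟ suc e ⌋)
    ≡⟨ cong (g zero false +_) (∑-cong (allFin k) (λ j → cong (g (suc j)) (⌊≟⌋-suc j e))) ⟩
  g zero false + ∑ (allFin k) (λ j → g (suc j) ⌊ j ≟ e ⌋) ≡⟨ cong (_+ ∑ (allFin k) (λ j → g (suc j) ⌊ j ≟ e ⌋)) (g-false≡0 zero) ⟩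
  ∑ (allFin k) (λ j → g (suc j) ⌊ j ≟ e ⌋)                ≡⟨ ∑-point e (g ∘ suc) (g-false≡0 ∘ suc) ⟩
  g (suc e) true                                           ∎
  where open ≡-Reasoning

halves : ℕ → ℚ
halves zero = 0ℚ
halves (suc n) = ½ +ℚ halves n

0≤½ : 0ℚ ≤ℚ ½
0≤½ = ℚ.nonNegative⁻¹ ½

halves-+ : ∀ m n → halves (m + n) ≡ halves m +ℚ halves n
halves-+ zero n = sym (ℚ.+-identityˡ (halves n))
halves-+ (suc m) n = trans (cong (½ +ℚ_) (halves-+ m n)) (sym (ℚ.+-assoc ½ (halves m) (halves n)))

halves-nonneg : ∀ n → 0ℚ ≤ℚ halves n
halves-nonneg zero = ℚ.≤-refl
halves-nonneg (suc n) = ℚ.+-mono-≤ 0≤½ (halves-nonneg n)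

halves-mono : ∀ {m n} → m ≤ n → halves m ≤ℚ halves n
halves-mono {n = n} z≤n = halves-nonneg n
halves-mono (s≤s m≤n) = ℚ.+-monoʳ-≤ ½ (halves-mono m≤n)

sumℚ-halves : {A : Set} (l : List A) (g : A → ℕ) → sumℚ (map (halves ∘ g) l) ≡ halves (∑ l g)
sumℚ-halves [] g = refl
sumℚ-halves (a ∷ l) g = trans (cong (halves (g a) +ℚ_) (sumℚ-halves l g)) (sym (halves-+ (g a) (∑ l g)))

∑-vertices : ∀ {k} (g : Vertex k → ℕ) → g s ≡ 0 → g t ≡ 0 →
             ∑ (allVertices k) g ≡ ∑ (allFin k) (g ∘ node x) + ∑ (allFin k) (g ∘ node y)
∑-vertices {k} g gs≡0 gt≡0 = begin
  g s + (g t + ∑ (Xₓ ++ Xᵧ) g)                  ≡⟨ cong₂ (λ m n → m + (n + ∑ (Xₓ ++ Xᵧ) g)) gs≡0 gt≡0 ⟩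
  ∑ (Xₓ ++ Xᵧ) g                                ≡⟨ ∑-++ Xₓ Xᵧ g ⟩
  ∑ Xₓ g + ∑ Xᵧ g                               ≡⟨ cong₂ _+_ (∑-map (node x) (allFin k) g) (∑-map (node y) (allFin k) g) ⟩
  ∑ (allFin k) (g ∘ node x) + ∑ (allFin k) (g ∘ node y) ∎
  where
  open ≡-Reasoning
  Xₓ Xᵧ : List (Vertex k)
  Xₓ = map (node x) (allFin k)
  Xᵧ = map (node y) (allFin k)

½-network : ∀ {k} → (Vertex k → Vertex k → Bool) → Capacity k
½-network e u w = if e u w then ½ else 0ℚ

½-network-nonneg : ∀ {k} (e : Vertex k → Vertex k → Bool) → NonNeg (½-network e)
½-network-nonneg e u w with e u w
... | true  = 0≤½
... | false = ℚ.≤-refl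

cutEdges : ∀ {k} → (Vertex k → Vertex k → Bool) → VSet k → ℕ
cutEdges {k} e S = ∑ (allVertices k) λ u → ∑ (allVertices k) λ w → [ e u w ∧ (S u ∧ not (S w)) ]

cutCap-½-network : ∀ {k} (e : Vertex k → Vertex k → Bool) (S : VSet k) →
                   cutCap (½-network e) S ≡ halves (cutEdges e S)
cutCap-½-network {k} e S =
  trans (cong sumℚ (map-cong (λ u → trans (cong sumℚ (map-cong (entry u) V)) (sumℚ-halves V (row u))) V))
        (sumℚ-halves V (λ u → ∑ V (row u)))
  where
  V : List (Vertex k)
  V = allVertices k
  row : Vertex k → Vertex k → ℕ
  row u w = [ e u w ∧ (S u ∧ not (S w)) ]
  entry : ∀ u w → (if S u ∧ not (S w) then ½-network e u w else 0ℚ) ≡ halves (row u w)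
  entry u w with S u ∧ not (S w) | e u w
  ... | true  | true  = refl
  ... | true  | false = refl
  ... | false | true  = refl
  ... | false | false = refl

-- The trace of a cut on X_v, seen from v_e: the number of other vertices v_i (i ≠ e) in the cut,
-- and whether v_e is in it.
Side : Set
Side = ℕ × Bool

occupancy : Side → ℕ
occupancy (A , a) = [ a ] + A

reduce : Side → Side
reduce p = if ⌊ occupancy p ℕ.≟ 1 ⌋ then p else (0 , false)

-- The number of edges of the network below leaving a cut whose traces are p (on X_x, from x_d)
-- and q (on X_y, from y_d′).
weight : Side → Side → ℕ
weight (A , a) (B , b) = (if b then 0 else A) + (if a then 0 else B)

weight-comm : ∀ p q → weight p q ≡ weight q p
weight-comm (A , a) (B , b) = +-comm (if b then 0 else A) (if a then 0 else B)

weight-single-multiple : ∀ p q → occupancy p ≡ 1 → occupancy q ≢ 1 → weight p (0 , false) ≤ weight p q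
weight-single-multiple (zero , true) q refl q≢1 = z≤n
weight-single-multiple (suc zero , false) (B , false) refl q≢1 = s≤s z≤n
weight-single-multiple (suc zero , false) (zero , true) refl q≢1 = ⊥-elim (q≢1 refl)
weight-single-multiple (suc zero , false) (suc B , true) refl q≢1 = s≤s z≤n

weight-reduce : ∀ p q → weight (reduce p) (reduce q) ≤ weight p q
weight-reduce p q with occupancy p ℕ.≟ 1 | occupancy q ℕ.≟ 1
... | yes p₁ | yes q₁ = ≤-refl
... | no p≢1 | no q≢1 = z≤n
... | yes p₁ | no q≢1 = weight-single-multiple p q p₁ q≢1
... | no p≢1 | yes q₁ = subst₂ _≤_ (weight-comm q (0 , false)) (weight-comm q p) (weight-single-multiple q p q₁ p≢1)

side : ∀ {k} → (D k → Bool) → D k → Side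
side {k} P e = ∑ (allFin k) (λ i → [ P i ∧ not ⌊ i ≟ e ⌋ ]) , P e

countIn-side : ∀ {k} (S : VSet k) (v : Var) (e : D k) → countIn S v ≡ occupancy (side (S ∘ node v) e)
countIn-side {k} S v e = begin
  countIn S v                                                      ≡⟨ length-filter-≡true P F ⟩
  ∑ F (λ i → [ P i ])                                              ≡⟨ ∑-cong F split ⟩
  ∑ F (λ i → (if ⌊ i ≟ e ⌋ then [ P i ] else 0) + [ P i ∧ not ⌊ i ≟ e ⌋ ])
    ≡⟨ ∑-+ F (λ i → if ⌊ i ≟ e ⌋ then [ P i ] else 0) (λ i → [ P i ∧ not ⌊ i ≟ e ⌋ ]) ⟩
  ∑ F (λ i → if ⌊ i ≟ e ⌋ then [ P i ] else 0) + ∑ F (λ i → [ P i ∧ not ⌊ i ≟ e ⌋ ])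
    ≡⟨ cong (_+ ∑ F (λ i → [ P i ∧ not ⌊ i ≟ e ⌋ ])) (∑-point e (λ i b → if b then [ P i ] else 0) (λ _ → refl)) ⟩
  occupancy (side P e)                                             ∎
  where
  open ≡-Reasoning
  F : List (D k)
  F = allFin k
  P : D k → Bool
  P = S ∘ node v
  split : ∀ i → [ P i ] ≡ (if ⌊ i ≟ e ⌋ then [ P i ] else 0) + [ P i ∧ not ⌊ i ≟ e ⌋ ]
  split i with P i | ⌊ i ≟ e ⌋
  ... | true  | true  = refl
  ... | true  | false = refl
  ... | false | true  = refl
  ... | false | false = refl

side-∧ : ∀ {k} (P : D k → Bool) (c : Bool) (e : D k) →
         side (λ i → P i ∧ c) e ≡ (if c then side P e else (0 , false))
side-∧ {k} P true e =
  cong₂ _,_ (∑-cong (allFin k) (λ i → cong (λ b → [ b ∧ not ⌊ i ≟ e ⌋ ]) (∧-identityʳ (P i)))) (∧-identityʳ (P e))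
side-∧ {k} P false e =
  cong₂ _,_ (∑-zero (allFin k) (λ i → cong (λ b → [ b ∧ not ⌊ i ≟ e ⌋ ]) (∧-zeroʳ (P i)))) (∧-zeroʳ (P e))

side-ν : ∀ {k} (S : VSet k) (v : Var) (e : D k) → side (ν S ∘ node v) e ≡ reduce (side (S ∘ node v) e)
side-ν S v e = trans (side-∧ (S ∘ node v) _ e)
  (cong (λ n → if ⌊ n ℕ.≟ 1 ⌋ then side (S ∘ node v) e else (0 , false)) (countIn-side S v e))

labelSide : ∀ {k} → D k → D′ k → Side
labelSide e zero = 0 , false
labelSide e (suc a) = [ not ⌊ a ≟ e ⌋ ] , ⌊ a ≟ e ⌋

side-Sφ : ∀ {k} (φ : Var → D′ k) (v : Var) (e : D k) → side (Sφ φ ∘ node v) e ≡ labelSide e (φ v)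
side-Sφ {k} φ v e with φ v
... | zero  = cong (_, false) (∑-zero (allFin k) (λ _ → refl))
... | suc a = cong₂ _,_ (trans (∑-cong (allFin k) flip) (∑-point a (λ i b → [ b ∧ not ⌊ i ≟ e ⌋ ]) (λ _ → refl)))
                        (⌊≟⌋-suc a e)
  where
  flip : ∀ i → [ ⌊ suc a ≟ suc i ⌋ ∧ not ⌊ i ≟ e ⌋ ] ≡ [ ⌊ i ≟ a ⌋ ∧ not ⌊ i ≟ e ⌋ ]
  flip i = cong (λ b → [ b ∧ not ⌊ i ≟ e ⌋ ]) (trans (⌊≟⌋-suc a i) (⌊≟⌋-sym a i))

[∧∧not]≡unless : ∀ a q r → [ a ∧ (q ∧ not r) ] ≡ (if r then 0 else [ q ∧ a ])
[∧∧not]≡unless a q true = cong [_] (trans (cong (a ∧_) (∧-zeroʳ q)) (∧-zeroʳ a))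
[∧∧not]≡unless a q false = cong [_] (trans (cong (a ∧_) (∧-identityʳ q)) (∧-comm a q))

module Network {k : ℕ} (d d′ : D k) where

  edge : Vertex k → Vertex k → Bool
  edge (node x i) (node y j) = ⌊ j ≟ d′ ⌋ ∧ not ⌊ i ≟ d ⌋
  edge (node y j) (node x i) = ⌊ i ≟ d ⌋ ∧ not ⌊ j ≟ d′ ⌋
  edge _ _ = false

  leaving : VSet k → Vertex k → Vertex k → ℕ
  leaving S u w = [ edge u w ∧ (S u ∧ not (S w)) ]

  leaving-x : (S : VSet k) (i : D k) →
              ∑ (allVertices k) (leaving S (node x i)) ≡ (if S (node y d′) then 0 else [ S (node x i) ∧ not ⌊ i ≟ d ⌋ ])
  leaving-x S i = begin
    ∑ (allVertices k) (leaving S (node x i))             ≡⟨ ∑-vertices (leaving S (node x i)) refl refl ⟩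
    ∑ F (λ _ → 0) + ∑ F (leaving S (node x i) ∘ node y)  ≡⟨ cong (_+ ∑ F (leaving S (node x i) ∘ node y)) (∑-zero F (λ _ → refl)) ⟩
    ∑ F (leaving S (node x i) ∘ node y)
      ≡⟨ ∑-point d′ (λ j b → [ (b ∧ not ⌊ i ≟ d ⌋) ∧ (S (node x i) ∧ not (S (node y j))) ]) (λ _ → refl) ⟩
    [ not ⌊ i ≟ d ⌋ ∧ (S (node x i) ∧ not (S (node y d′))) ]
      ≡⟨ [∧∧not]≡unless (not ⌊ i ≟ d ⌋) (S (node x i)) (S (node y d′)) ⟩
    (if S (node y d′) then 0 else [ S (node x i) ∧ not ⌊ i ≟ d ⌋ ]) ∎
    where
    open ≡-Reasoning
    F : List (D k)
    F = allFin k

  leaving-y : (S : VSet k) (j : D k) →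
              ∑ (allVertices k) (leaving S (node y j)) ≡ (if S (node x d) then 0 else [ S (node y j) ∧ not ⌊ j ≟ d′ ⌋ ])
  leaving-y S j = begin
    ∑ (allVertices k) (leaving S (node y j))             ≡⟨ ∑-vertices (leaving S (node y j)) refl refl ⟩
    ∑ F (leaving S (node y j) ∘ node x) + ∑ F (λ _ → 0)  ≡⟨ cong (∑ F (leaving S (node y j) ∘ node x) +_) (∑-zero F (λ _ → refl)) ⟩
    ∑ F (leaving S (node y j) ∘ node x) + 0              ≡⟨ +-identityʳ _ ⟩
    ∑ F (leaving S (node y j) ∘ node x)
      ≡⟨ ∑-point d (λ i b → [ (b ∧ not ⌊ j ≟ d′ ⌋) ∧ (S (node y j) ∧ not (S (node x i))) ]) (λ _ → refl) ⟩
    [ not ⌊ j ≟ d′ ⌋ ∧ (S (node y j) ∧ not (S (node x d))) ]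
      ≡⟨ [∧∧not]≡unless (not ⌊ j ≟ d′ ⌋) (S (node y j)) (S (node x d)) ⟩
    (if S (node x d) then 0 else [ S (node y j) ∧ not ⌊ j ≟ d′ ⌋ ]) ∎
    where
    open ≡-Reasoning
    F : List (D k)
    F = allFin k

  cutEdges-weight : (S : VSet k) → cutEdges edge S ≡ weight (side (S ∘ node x) d) (side (S ∘ node y) d′)
  cutEdges-weight S = begin
    ∑ V out                                  ≡⟨ ∑-vertices out (∑-zero V (λ _ → refl)) (∑-zero V (λ _ → refl)) ⟩
    ∑ F (out ∘ node x) + ∑ F (out ∘ node y)  ≡⟨ cong₂ _+_ (∑-cong F (leaving-x S)) (∑-cong F (leaving-y S)) ⟩
    ∑ F (λ i → if S (node y d′) then 0 else [ S (node x i) ∧ not ⌊ i ≟ d ⌋ ]) +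
    ∑ F (λ j → if S (node x d) then 0 else [ S (node y j) ∧ not ⌊ j ≟ d′ ⌋ ])
      ≡⟨ cong₂ _+_ (∑-unless F (S (node y d′)) _) (∑-unless F (S (node x d)) _) ⟩
    weight (side (S ∘ node x) d) (side (S ∘ node y) d′) ∎
    where
    open ≡-Reasoning
    V : List (Vertex k)
    V = allVertices k
    F : List (D k)
    F = allFin k
    out : Vertex k → ℕ
    out u = ∑ V (leaving S u)

  capacity : Capacity k
  capacity = ½-network edge

  cutCap-weight : (S : VSet k) → cutCap capacity S ≡ halves (weight (side (S ∘ node x) d) (side (S ∘ node y) d′))
  cutCap-weight S = trans (cutCap-½-network edge S) (cong halves (cutEdges-weight S))

  k-submodular : IsKSubmodularNetwork capacity
  k-submodular S _ = begin
    cutCap capacity (ν S)                                                    ≡⟨ cutCap-weight (ν S) ⟩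
    halves (weight (side (ν S ∘ node x) d) (side (ν S ∘ node y) d′))        ≡⟨ cong halves (cong₂ weight (side-ν S x d) (side-ν S y d′)) ⟩
    halves (weight (reduce (side (S ∘ node x) d)) (reduce (side (S ∘ node y) d′)))
      ≤⟨ halves-mono (weight-reduce (side (S ∘ node x) d) (side (S ∘ node y) d′)) ⟩
    halves (weight (side (S ∘ node x) d) (side (S ∘ node y) d′))             ≡⟨ cutCap-weight S ⟨
    cutCap capacity S                                                        ∎
    where open ℚ.≤-Reasoning

  halves-weight-labelSide : ∀ a b → halves (weight (labelSide d a) (labelSide d′ b)) ≡ f₀ d d′ a b
  halves-weight-labelSide zero zero = refl
  halves-weight-labelSide (suc a) zero with ⌊ a ≟ d ⌋
  ... | true  = refl
  ... | false = refl
  halves-weight-labelSide zero (suc b) with ⌊ b ≟ d′ ⌋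
  ... | true  = refl
  ... | false = refl
  halves-weight-labelSide (suc a) (suc b) with ⌊ a ≟ d ⌋ | ⌊ b ≟ d′ ⌋
  ... | true  | true  = refl
  ... | true  | false = refl
  ... | false | true  = refl
  ... | false | false = refl

  represents : Represents capacity (fφ d d′)
  represents φ = begin
    cutCap capacity (Sφ φ)                                                   ≡⟨ cutCap-weight (Sφ φ) ⟩
    halves (weight (side (Sφ φ ∘ node x) d) (side (Sφ φ ∘ node y) d′))      ≡⟨ cong halves (cong₂ weight (side-Sφ φ x d) (side-Sφ φ y d′)) ⟩
    halves (weight (labelSide d (φ x)) (labelSide d′ (φ y)))                ≡⟨ halves-weight-labelSide (φ x) (φ y) ⟩
    fφ d d′ φ                                                                ∎
    where open ≡-Reasoning

lemma6p10 : (k : ℕ) (d d′ : D k) → KSubmodularRepresentable (fφ d d′)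
lemma6p10 k d d′ = capacity , ½-network-nonneg edge , represents , k-submodular
  where open Network d d′
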